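{- Let $n,k,t$ be integers with $1\le t<k<n$. Let $\mathcal F\subset\binom{[n]}{k}$ be an intersecting family with maximum degree $\Delta=\Delta(\mathcal F)$ and diversity $\gamma=\gamma(\mathcal F)$. If $$\Delta+\frac{k}{k-t}\gamma\le\binom{n-1}{k-1},$$ then $\delta_t(\mathcal F)\le\binom{n-t-1}{k-t-1}$.
   Context: $\binom{[n]}{k}$ is the set of $k$-element subsets of $[n]=\{1,\dots,n\}$. A family is intersecting if any two of its sets intersect. The degree of $i\in[n]$ is the number of sets of $\mathcal F$ containing $i$; $\Delta(\mathcal F)$ is the maximum degree of an element, and the diversity is $\gamma(\mathcal F)=|\mathcal F|-\Delta(\mathcal F)$. For $S\subset[n]$, its degree is the number of sets of $\mathcal F$ containing $S$, and $\delta_t(\mathcal F)$ is the minimum degree of a $t$-element subset of $[n]$. -}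

module Defs where

open import Data.Nat using (ℕ; zero; suc; _⊔_; _⊓_; _≡ᵇ_)
open import Data.Bool using (Bool; true; false)
open import Data.Fin using (Fin)
open import Data.Fin.Subset using (Subset; _∈_; _⊆_; _∩_; Nonempty; ∣_∣; inside; outside)
open import Data.Fin.Subset.Properties using (_∈?_; _⊆?_)
open import Data.List using (List; []; _∷_; _++_; map; filter; length; foldr; allFin)
open import Data.List.Relation.Unary.All using (All)
open import Data.List.Relation.Unary.Unique.Propositional using (Unique)
import Data.List.Membership.Propositional as Mem
open import Data.Vec using (_∷_; [])
open import Relation.Binary.PropositionalEquality using (_≡_)

Family : ℕ → Set
Family n = List (Subset n)

IsKUniformFamily : ∀ {n} → ℕ → Family n → Set
IsKUniformFamily k F = Unique F × All (λ A → ∣ A ∣ ≡ k) F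
  where open import Data.Product using (_×_)

Intersecting : ∀ {n} → Family n → Set
Intersecting F = ∀ {A B} → A Mem.∈ F → B Mem.∈ F → Nonempty (A ∩ B)

degree : ∀ {n} → Family n → Fin n → ℕ
degree F i = length (filter (i ∈?_) F)

setDegree : ∀ {n} → Family n → Subset n → ℕ
setDegree F S = length (filter (S ⊆?_) F)

maxDegree : ∀ {n} → Family n → ℕ
maxDegree {n} F = foldr _⊔_ 0 (map (degree F) (allFin n))

-- diversity γ(F) = |F| - Δ(F)   (Δ ≤ |F| always, so truncated subtraction is exact)
diversity : ∀ {n} → Family n → ℕ
diversity F = length F ∸ maxDegree F
  where open import Data.Nat using (_∸_)

allSubsets : (n : ℕ) → List (Subset n)
allSubsets zero = [] ∷ []
allSubsets (suc n) = map (outside ∷_) (allSubsets n) ++ map (inside ∷_) (allSubsets n)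

subsetsOfSize : (n t : ℕ) → List (Subset n)
subsetsOfSize n t = filter (λ S → ∣ S ∣ Data.Nat.≟ t) (allSubsets n)
  where import Data.Nat

-- minimum of a list (0 on the empty list; only used on nonempty lists)
minList : List ℕ → ℕ
minList [] = 0
minList (x ∷ []) = x
minList (x ∷ y ∷ xs) = x ⊓ minList (y ∷ xs)

minDegree : ∀ {n} → ℕ → Family n → ℕ
minDegree {n} t F = minList (map (setDegree F) (subsetsOfSize n t))

{-# OPTIONS --safe #-}
module Submission where

-- Let x have maximum degree Δ and double count the pairs (T, A) with T a t-set avoiding x and
-- T ⊆ A ∈ F: a member A contains C(k-1,t) such T if x ∈ A and C(k,t) otherwise, so the degrees
-- of the C(n-1,t) t-sets avoiding x sum to Δ C(k-1,t) + γ C(k,t) = C(k-1,t) ((k-t)Δ + kγ)/(k-t).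
-- By the hypothesis this is at most C(k-1,t) C(n-1,k-1) = C(n-1,t) C(n-t-1,k-t-1), so one of
-- those t-sets has degree at most C(n-t-1,k-t-1).

open import Data.Bool using (true; false)
open import Data.Fin using (Fin; zero; suc)
open import Data.Fin.Subset using (Subset; inside; outside; _∈_; _∉_; _⊆_; _─_; _-_; ⊤; ∣_∣)
open import Data.Fin.Subset.Properties
  using (_∈?_; _⊆?_; p─⊥≡p; p─q⊆p; x∈p∧x∉q⇒x∈p─q; ∈⊤; ∣⊤∣≡n)
open import Data.List using (List; []; _∷_; _++_; map; filter; length; foldr; allFin)
open import Data.List.Membership.Propositional using (find)
import Data.List.Membership.Propositional as List
open import Data.List.Membership.Propositional.Properties using (∈-map⁺; ∈-map⁻; ∈-filter⁺; ∈-filter⁻)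
open import Data.List.Properties using (filter-≐; filter-++; filter-none; length-++)
open import Data.List.Relation.Unary.All as All using (All; []; _∷_)
open import Data.List.Relation.Unary.All.Properties using (¬Any⇒All¬; all-filter; filter⁺)
open import Data.List.Relation.Unary.Any using (Any; any?; here; there)
open import Data.Nat
  using (ℕ; zero; suc; _+_; _*_; _∸_; _≤_; _<_; _⊔_; _⊓_; _≟_; _≤?_; z≤n; s≤s; NonZero; _!; >-nonZero; >-nonZero⁻¹)
open import Data.Nat.Combinatorics using (_C_; nCk+nC[k+1]≡[n+1]C[k+1]; nCk≡n!/k![n-k]!; k![n∸k]!∣n!)
open import Data.Nat.DivMod using (_/_; m/n*n≡m)
open import Data.Nat.ListAction using (sum)
open import Data.Nat.Properties
open import Algebra.Properties.CommutativeSemigroup +-commutativeSemigroup using (x∙yz≈y∙xz)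
open import Data.Nat.Tactic.RingSolver using (solve-∀)
open import Data.Product using (_×_; _,_; ∃-syntax)
open import Data.Sum using (inj₁; inj₂)
open import Data.Vec using (_∷_; []; here; there)
open import Function using (_∘_)
open import Level using (Level)
open import Relation.Binary.PropositionalEquality
open import Relation.Nullary using (¬_; Dec; does; yes; no; contradiction)
open import Relation.Nullary.Decidable using (_×-dec_)
open import Relation.Unary using (Pred; Decidable; _≐_)
open import Relation.Unary.Properties using (∁?; _∩?_)

open import Defs

private
  variable
    a ℓ ℓ′ : Level
    A B : Set a
    n : ℕ
    x : Fin n
    p q : Subset n

count : {P : Pred A ℓ} → Decidable P → List A → ℕ
count P? xs = length (filter P? xs)

count-cong-does : {P : Pred A ℓ} {Q : Pred A ℓ′} (P? : Decidable P) (Q? : Decidable Q) →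
  (∀ x → does (P? x) ≡ does (Q? x)) → ∀ xs → count P? xs ≡ count Q? xs
count-cong-does P? Q? eq [] = refl
count-cong-does P? Q? eq (x ∷ xs) with does (P? x) | does (Q? x) | eq x
... | true  | .true  | refl = cong suc (count-cong-does P? Q? eq xs)
... | false | .false | refl = count-cong-does P? Q? eq xs

module _ {P : Pred A ℓ} (P? : Decidable P) where

  count-≐ : {Q : Pred A ℓ′} (Q? : Decidable Q) → P ≐ Q → ∀ xs → count P? xs ≡ count Q? xs
  count-≐ Q? P≐Q xs = cong length (filter-≐ P? Q? P≐Q xs)

  count-++ : ∀ xs ys → count P? (xs ++ ys) ≡ count P? xs + count P? ys
  count-++ xs ys = trans (cong length (filter-++ P? xs ys)) (length-++ (filter P? xs))

  count-map : (f : B → A) → ∀ xs → count P? (map f xs) ≡ count (λ x → P? (f x)) xs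
  count-map f [] = refl
  count-map f (x ∷ xs) with does (P? (f x))
  ... | true  = cong suc (count-map f xs)
  ... | false = count-map f xs

  count-filter : {Q : Pred A ℓ′} (Q? : Decidable Q) → ∀ xs → count Q? (filter P? xs) ≡ count (P? ∩? Q?) xs
  count-filter Q? [] = refl
  count-filter Q? (x ∷ xs) with does (P? x)
  ... | false = count-filter Q? xs
  ... | true with does (Q? x)
  ...   | true  = cong suc (count-filter Q? xs)
  ...   | false = count-filter Q? xs

  length≡count+count∁ : ∀ xs → length xs ≡ count P? xs + count (∁? P?) xs
  length≡count+count∁ [] = refl
  length≡count+count∁ (x ∷ xs) with does (P? x)
  ... | true  = cong suc (length≡count+count∁ xs)
  ... | false = trans (cong suc (length≡count+count∁ xs)) (sym (+-suc _ _))

  sum-map-partition : (f : A → ℕ) → ∀ xs →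
    sum (map f xs) ≡ sum (map f (filter P? xs)) + sum (map f (filter (∁? P?) xs))
  sum-map-partition f [] = refl
  sum-map-partition f (x ∷ xs) with does (P? x)
  ... | true  = trans (cong (f x +_) (sum-map-partition f xs)) (sym (+-assoc (f x) _ _))
  ... | false = trans (cong (f x +_) (sum-map-partition f xs)) (x∙yz≈y∙xz (f x) (sum (map f (filter P? xs))) _)

sum-map-const : (f : A → ℕ) {c : ℕ} → ∀ {xs} → All (λ x → f x ≡ c) xs → sum (map f xs) ≡ length xs * c
sum-map-const f [] = refl
sum-map-const f (fx≡c ∷ fxs≡c) = cong₂ _+_ fx≡c (sum-map-const f fxs≡c)

length*≤sum-map : (f : A → ℕ) {m : ℕ} → ∀ {xs} → All (λ x → m ≤ f x) xs → length xs * m ≤ sum (map f xs)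
length*≤sum-map f [] = z≤n
length*≤sum-map f (m≤fx ∷ m≤fxs) = +-mono-≤ m≤fx (length*≤sum-map f m≤fxs)

sum≤length*m⇒Any≤m : (f : A → ℕ) (m : ℕ) → ∀ xs → 0 < length xs →
  sum (map f xs) ≤ length xs * m → Any (λ x → f x ≤ m) xs
sum≤length*m⇒Any≤m f m xs 0<len sum≤ with any? (λ x → f x ≤? m) xs
... | yes some = some
... | no none = contradiction sum≤ (<⇒≱ (begin-strict
      length xs * m      <⟨ *-monoʳ-< (length xs) {{>-nonZero 0<len}} (n<1+n m) ⟩
      length xs * suc m  ≤⟨ length*≤sum-map f (All.map ≰⇒> (¬Any⇒All¬ xs none)) ⟩
      sum (map f xs)     ∎))
  where open ≤-Reasoning

module _ {R : A → B → Set ℓ} (R? : ∀ x y → Dec (R x y)) where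

  sum-map-count-∷ : ∀ x xs ys →
    sum (map (λ y → count (λ x′ → R? x′ y) (x ∷ xs)) ys) ≡
    count (R? x) ys + sum (map (λ y → count (λ x′ → R? x′ y) xs) ys)
  sum-map-count-∷ x xs [] = refl
  sum-map-count-∷ x xs (y ∷ ys) with does (R? x y)
  ... | true  = cong suc (trans (cong (c +_) (sum-map-count-∷ x xs ys)) (x∙yz≈y∙xz c (count (R? x) ys) _))
    where c = count (λ x′ → R? x′ y) xs
  ... | false = trans (cong (c +_) (sum-map-count-∷ x xs ys)) (x∙yz≈y∙xz c (count (R? x) ys) _)
    where c = count (λ x′ → R? x′ y) xs

  sum-map-count-swap : ∀ xs ys →
    sum (map (λ x → count (R? x) ys) xs) ≡ sum (map (λ y → count (λ x → R? x y) xs) ys)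
  sum-map-count-swap [] ys = sym (trans (sum-map-const _ (All.universal (λ _ → refl) ys)) (*-zeroʳ (length ys)))
  sum-map-count-swap (x ∷ xs) ys =
    trans (cong (count (R? x) ys +_) (sum-map-count-swap xs ys)) (sym (sum-map-count-∷ x xs ys))

∈-choose? : (B : Subset n) (t : ℕ) → Decidable (λ T → T ⊆ B × ∣ T ∣ ≡ t)
∈-choose? B t T = T ⊆? B ×-dec ∣ T ∣ ≟ t

_choose_ : Subset n → ℕ → List (Subset n)
B choose t = filter (∈-choose? B t) (allSubsets _)

private
  inside∷-count : ∀ b (B : Subset n) t → ℕ
  inside∷-count {n} b B t = count (λ T → ∈-choose? (b ∷ B) t (inside ∷ T)) (allSubsets n)

  length-choose-∷ : ∀ b (B : Subset n) t → length ((b ∷ B) choose t) ≡ length (B choose t) + inside∷-count b B t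
  length-choose-∷ {n} b B t = begin
    count Q? (map (outside ∷_) all ++ map (inside ∷_) all)
      ≡⟨ count-++ Q? (map (outside ∷_) all) (map (inside ∷_) all) ⟩
    count Q? (map (outside ∷_) all) + count Q? (map (inside ∷_) all)
      ≡⟨ cong₂ _+_ (count-map Q? (outside ∷_) all) (count-map Q? (inside ∷_) all) ⟩
    count (λ T → Q? (outside ∷ T)) all + inside∷-count b B t
      ≡⟨ cong (_+ inside∷-count b B t) (count-cong-does _ (∈-choose? B t) (λ _ → refl) all) ⟩
    length (B choose t) + inside∷-count b B t
      ∎
    where
    open ≡-Reasoning
    all = allSubsets n
    Q? = ∈-choose? (b ∷ B) t

length-choose : (B : Subset n) (t : ℕ) → length (B choose t) ≡ ∣ B ∣ C t
length-choose [] zero = refl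
length-choose [] (suc t) = refl
length-choose {suc n} (outside ∷ B) t = begin
  length ((outside ∷ B) choose t)           ≡⟨ length-choose-∷ outside B t ⟩
  length (B choose t) + inside∷-count outside B t
    ≡⟨ cong₂ _+_ (length-choose B t) (cong length (filter-none _ {allSubsets n} (All.universal inside⊈outside _))) ⟩
  ∣ B ∣ C t + 0                             ≡⟨ +-identityʳ _ ⟩
  ∣ B ∣ C t                                 ∎
  where
  open ≡-Reasoning
  inside⊈outside : ∀ T → ¬ (inside ∷ T ⊆ outside ∷ B × ∣ inside ∷ T ∣ ≡ t)
  inside⊈outside T (⊆ , _) with ⊆ here
  ... | ()
length-choose {suc n} (inside ∷ B) zero = begin
  length ((inside ∷ B) choose 0)            ≡⟨ length-choose-∷ inside B 0 ⟩
  length (B choose 0) + inside∷-count inside B 0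
    ≡⟨ cong₂ _+_ (length-choose B 0) (cong length (filter-none _ {allSubsets n} (All.universal (λ T → λ ()) _))) ⟩
  1                                         ∎
  where open ≡-Reasoning
length-choose {suc n} (inside ∷ B) (suc t) = begin
  length ((inside ∷ B) choose suc t)        ≡⟨ length-choose-∷ inside B (suc t) ⟩
  length (B choose suc t) + inside∷-count inside B (suc t)
    ≡⟨ cong (length (B choose suc t) +_) (count-cong-does _ (∈-choose? B t) (λ _ → refl) (allSubsets n)) ⟩
  length (B choose suc t) + length (B choose t)
    ≡⟨ cong₂ _+_ (length-choose B (suc t)) (length-choose B t) ⟩
  ∣ B ∣ C suc t + ∣ B ∣ C t                 ≡⟨ +-comm (∣ B ∣ C suc t) (∣ B ∣ C t) ⟩
  ∣ B ∣ C t + ∣ B ∣ C suc t                 ≡⟨ nCk+nC[k+1]≡[n+1]C[k+1] ∣ B ∣ t ⟩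
  suc ∣ B ∣ C suc t                         ∎
  where open ≡-Reasoning

x∉p⇒p-x≡p : x ∉ p → p - x ≡ p
x∉p⇒p-x≡p {x = zero}  {p = outside ∷ p} _   = cong (outside ∷_) (p─⊥≡p p)
x∉p⇒p-x≡p {x = zero}  {p = inside ∷ p}  x∉p = contradiction here x∉p
x∉p⇒p-x≡p {x = suc x} {p = s ∷ p}       x∉p = cong (s ∷_) (x∉p⇒p-x≡p (x∉p ∘ there))

x∈p⇒1+∣p-x∣≡∣p∣ : x ∈ p → suc ∣ p - x ∣ ≡ ∣ p ∣
x∈p⇒1+∣p-x∣≡∣p∣ {p = inside ∷ p}  here        = cong (suc ∘ ∣_∣) (p─⊥≡p p)
x∈p⇒1+∣p-x∣≡∣p∣ {p = inside ∷ p}  (there x∈p) = cong suc (x∈p⇒1+∣p-x∣≡∣p∣ x∈p)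
x∈p⇒1+∣p-x∣≡∣p∣ {p = outside ∷ p} (there x∈p) = x∈p⇒1+∣p-x∣≡∣p∣ x∈p

x∈p─q⇒x∉q : x ∈ p ─ q → x ∉ q
x∈p─q⇒x∉q {p = _ ∷ p} {q = outside ∷ q} (there x∈p─q) (there x∈q) = x∈p─q⇒x∉q x∈p─q x∈q
x∈p─q⇒x∉q {p = _ ∷ p} {q = inside ∷ q}  (there x∈p─q) (there x∈q) = x∈p─q⇒x∉q x∈p─q x∈q

∣⊤-x∣≡n : (x : Fin (suc n)) → ∣ ⊤ - x ∣ ≡ n
∣⊤-x∣≡n {n} x = suc-injective (trans (x∈p⇒1+∣p-x∣≡∣p∣ {x = x} {p = ⊤} ∈⊤) (∣⊤∣≡n (suc n)))

p⊆⊤-x⇒p⊆q⇒p⊆q-x : p ⊆ ⊤ - x → p ⊆ q → p ⊆ q - x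
p⊆⊤-x⇒p⊆q⇒p⊆q-x p⊆⊤-x p⊆q y∈p = x∈p∧x∉q⇒x∈p─q (p⊆q y∈p) (x∈p─q⇒x∉q (p⊆⊤-x y∈p))

p⊆q-x⇒p⊆⊤-x : p ⊆ q - x → p ⊆ ⊤ - x
p⊆q-x⇒p⊆⊤-x p⊆q-x y∈p = x∈p∧x∉q⇒x∈p─q ∈⊤ (x∈p─q⇒x∉q (p⊆q-x y∈p))

count-⊆-choose : (A : Subset n) (x : Fin n) (t : ℕ) →
  count (_⊆? A) ((⊤ - x) choose t) ≡ length ((A - x) choose t)
count-⊆-choose A x t = trans (count-filter (∈-choose? (⊤ - x) t) (_⊆? A) (allSubsets _))
  (count-≐ (∈-choose? (⊤ - x) t ∩? (_⊆? A)) (∈-choose? (A - x) t)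
    ( (λ {T} ((⊆⊤-x , ∣T∣≡t) , ⊆A) → p⊆⊤-x⇒p⊆q⇒p⊆q-x ⊆⊤-x ⊆A , ∣T∣≡t)
    , (λ {T} (⊆A-x , ∣T∣≡t) → (p⊆q-x⇒p⊆⊤-x ⊆A-x , ∣T∣≡t) , (λ {y} y∈T → p─q⊆p A _ (⊆A-x y∈T))))
    (allSubsets _))

[a+b]Ca*a!*b!≡[a+b]! : ∀ a b → ((a + b) C a) * (a ! * b !) ≡ (a + b) !
[a+b]Ca*a!*b!≡[a+b]! a b = begin
  ((a + b) C a) * (a ! * b !)                 ≡⟨ cong (λ m → ((a + b) C a) * (a ! * m !)) (m+n∸m≡n a b) ⟨
  ((a + b) C a) * a![a+b∸a]!                  ≡⟨ cong (_* a![a+b∸a]!) (nCk≡n!/k![n-k]! a≤a+b) ⟩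
  (a + b) ! / a![a+b∸a]! * a![a+b∸a]!         ≡⟨ m/n*n≡m (k![n∸k]!∣n! a≤a+b) ⟩
  (a + b) !                                   ∎
  where
  open ≡-Reasoning
  a≤a+b = m≤m+n a b
  a![a+b∸a]! = a ! * (a + b ∸ a) !
  instance _ = a !* (a + b ∸ a) !≢0

[1+b]*[1+a+b]Ca≡[1+a+b]*[a+b]Ca : ∀ a b → suc b * (suc (a + b) C a) ≡ suc (a + b) * ((a + b) C a)
[1+b]*[1+a+b]Ca≡[1+a+b]*[a+b]Ca a b = *-cancelʳ-≡ _ _ (a ! * b !) {{a !* b !≢0}} (begin
  suc b * X * (a ! * b !)          ≡⟨ rearrange (suc b) X (a !) (b !) ⟩
  X * (a ! * suc b !)              ≡⟨ cong (λ m → (m C a) * (a ! * suc b !)) (+-suc a b) ⟨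
  ((a + suc b) C a) * (a ! * suc b !) ≡⟨ [a+b]Ca*a!*b!≡[a+b]! a (suc b) ⟩
  (a + suc b) !                    ≡⟨ cong _! (+-suc a b) ⟩
  suc (a + b) * (a + b) !          ≡⟨ cong (suc (a + b) *_) ([a+b]Ca*a!*b!≡[a+b]! a b) ⟨
  suc (a + b) * (Y * (a ! * b !))  ≡⟨ *-assoc (suc (a + b)) Y _ ⟨
  suc (a + b) * Y * (a ! * b !)    ∎)
  where
  open ≡-Reasoning
  X = suc (a + b) C a
  Y = (a + b) C a
  rearrange : ∀ p q r s → p * q * (r * s) ≡ q * (r * (p * s))
  rearrange = solve-∀

[a+b+c]C[a+b]*[a+b]Ca≡[a+b+c]Ca*[b+c]Cb : ∀ a b c →
  ((a + b + c) C (a + b)) * ((a + b) C a) ≡ ((a + b + c) C a) * ((b + c) C b)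
[a+b+c]C[a+b]*[a+b]Ca≡[a+b+c]Ca*[b+c]Cb a b c = *-cancelʳ-≡ _ _ (a ! * b ! * c !) {{nz}} (begin
  W * Y * (a ! * b ! * c !)        ≡⟨ rearrangeˡ W Y (a !) (b !) (c !) ⟩
  W * (Y * (a ! * b !) * c !)      ≡⟨ cong (λ m → W * (m * c !)) ([a+b]Ca*a!*b!≡[a+b]! a b) ⟩
  W * ((a + b) ! * c !)            ≡⟨ [a+b]Ca*a!*b!≡[a+b]! (a + b) c ⟩
  (a + b + c) !                    ≡⟨ cong _! (+-assoc a b c) ⟩
  (a + (b + c)) !                  ≡⟨ [a+b]Ca*a!*b!≡[a+b]! a (b + c) ⟨
  U′ * (a ! * (b + c) !)           ≡⟨ cong (λ m → U′ * (a ! * m)) ([a+b]Ca*a!*b!≡[a+b]! b c) ⟨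
  U′ * (a ! * (V * (b ! * c !)))   ≡⟨ cong (λ m → (m C a) * (a ! * (V * (b ! * c !)))) (+-assoc a b c) ⟨
  U * (a ! * (V * (b ! * c !)))    ≡⟨ rearrangeʳ U V (a !) (b !) (c !) ⟩
  U * V * (a ! * b ! * c !)        ∎)
  where
  open ≡-Reasoning
  W = (a + b + c) C (a + b)
  Y = (a + b) C a
  U = (a + b + c) C a
  U′ = (a + (b + c)) C a
  V = (b + c) C b
  nz : NonZero (a ! * b ! * c !)
  nz = m*n≢0 (a ! * b !) (c !) {{a !* b !≢0}} {{c !≢0}}
  rearrangeˡ : ∀ p q r s u → p * q * (r * s * u) ≡ p * (q * (r * s) * u)
  rearrangeˡ = solve-∀
  rearrangeʳ : ∀ p q r s u → p * (r * (q * (s * u))) ≡ p * q * (r * s * u)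
  rearrangeʳ = solve-∀

foldr-⊔-∈ : ∀ m ms → foldr _⊔_ 0 (m ∷ ms) List.∈ m ∷ ms
foldr-⊔-∈ m [] = here (⊔-identityʳ m)
foldr-⊔-∈ m (m′ ∷ ms) with ⊔-sel m (foldr _⊔_ 0 (m′ ∷ ms))
... | inj₁ ≡m = here ≡m
... | inj₂ ≡max = there (subst (List._∈ m′ ∷ ms) (sym ≡max) (foldr-⊔-∈ m′ ms))

maxDegree-attained : (F : Family (suc n)) → ∃[ x ] degree F x ≡ maxDegree F
maxDegree-attained {n} F with ∈-map⁻ (degree F) {xs = allFin (suc n)} (foldr-⊔-∈ _ _)
... | x , _ , max≡ = x , sym max≡

minList-≤ : ∀ {m} ms → m List.∈ ms → minList ms ≤ m
minList-≤ (m ∷ [])      (here refl) = ≤-refl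
minList-≤ (m ∷ m′ ∷ ms) (here refl) = m⊓n≤m m _
minList-≤ (m ∷ m′ ∷ ms) (there m∈) = ≤-trans (m⊓n≤n m _) (minList-≤ (m′ ∷ ms) m∈)

minDegree≤setDegree : ∀ t (F : Family n) {T} → T List.∈ subsetsOfSize n t → minDegree t F ≤ setDegree F T
minDegree≤setDegree t F T∈ = minList-≤ _ (∈-map⁺ (setDegree F) T∈)

module _ {K : ℕ} (t : ℕ) (x : Fin n) where

  count-⊆-choose-∈ : ∀ {A} → x ∈ A → ∣ A ∣ ≡ suc K → count (_⊆? A) ((⊤ - x) choose t) ≡ K C t
  count-⊆-choose-∈ {A} x∈A ∣A∣≡1+K = begin
    count (_⊆? A) ((⊤ - x) choose t) ≡⟨ count-⊆-choose A x t ⟩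
    length ((A - x) choose t)        ≡⟨ length-choose (A - x) t ⟩
    ∣ A - x ∣ C t                    ≡⟨ cong (_C t) (suc-injective (trans (x∈p⇒1+∣p-x∣≡∣p∣ x∈A) ∣A∣≡1+K)) ⟩
    K C t                            ∎
    where open ≡-Reasoning

  count-⊆-choose-∉ : ∀ {A} → x ∉ A → ∣ A ∣ ≡ suc K → count (_⊆? A) ((⊤ - x) choose t) ≡ suc K C t
  count-⊆-choose-∉ {A} x∉A ∣A∣≡1+K = begin
    count (_⊆? A) ((⊤ - x) choose t) ≡⟨ count-⊆-choose A x t ⟩
    length ((A - x) choose t)        ≡⟨ length-choose (A - x) t ⟩
    ∣ A - x ∣ C t                    ≡⟨ cong (λ B → ∣ B ∣ C t) (x∉p⇒p-x≡p x∉A) ⟩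
    ∣ A ∣ C t                        ≡⟨ cong (_C t) ∣A∣≡1+K ⟩
    suc K C t                        ∎
    where open ≡-Reasoning

  sum-setDegree-avoiding : (F : Family n) → All (λ A → ∣ A ∣ ≡ suc K) F →
    sum (map (setDegree F) ((⊤ - x) choose t)) ≡
    degree F x * (K C t) + count (∁? (x ∈?_)) F * (suc K C t)
  sum-setDegree-avoiding F sizes = begin
    sum (map (setDegree F) Ts)
      ≡⟨ sum-map-count-swap _⊆?_ Ts F ⟩
    sum (map below F)
      ≡⟨ sum-map-partition (x ∈?_) below F ⟩
    sum (map below (filter (x ∈?_) F)) + sum (map below (filter (∁? (x ∈?_)) F))
      ≡⟨ cong₂ _+_ (sum-map-const below below-∈) (sum-map-const below below-∉) ⟩
    degree F x * (K C t) + count (∁? (x ∈?_)) F * (suc K C t)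
      ∎
    where
    open ≡-Reasoning
    Ts = (⊤ - x) choose t

    below : Subset n → ℕ
    below A = count (_⊆? A) Ts

    below-∈ : All (λ A → below A ≡ K C t) (filter (x ∈?_) F)
    below-∈ = All.zipWith (λ (x∈A , ∣A∣≡) → count-⊆-choose-∈ x∈A ∣A∣≡)
                (all-filter (x ∈?_) F , filter⁺ (x ∈?_) sizes)

    below-∉ : All (λ A → below A ≡ suc K C t) (filter (∁? (x ∈?_)) F)
    below-∉ = All.zipWith (λ (x∉A , ∣A∣≡) → count-⊆-choose-∉ x∉A ∣A∣≡)
                (all-filter (∁? (x ∈?_)) F , filter⁺ (∁? (x ∈?_)) sizes)

0<[a+b]Ca : ∀ a b → 0 < (a + b) C a
0<[a+b]Ca a b = >-nonZero⁻¹ _ {{m*n≢0⇒m≢0 ((a + b) C a) {{nonZero-product}}}}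
  where
  nonZero-product : NonZero (((a + b) C a) * (a ! * b !))
  nonZero-product = subst NonZero (sym ([a+b]Ca*a!*b!≡[a+b]! a b)) ((a + b) !≢0)

choose⊆subsetsOfSize : ∀ {B : Subset n} {t T} → T List.∈ B choose t → T List.∈ subsetsOfSize n t
choose⊆subsetsOfSize {n} {t = t} T∈ with ∈-filter⁻ (∈-choose? _ t) T∈
... | T∈all , _ , ∣T∣≡t = ∈-filter⁺ (λ S → ∣ S ∣ ≟ t) {xs = allSubsets n} T∈all ∣T∣≡t

D*[t+b]Ct+E*[1+t+b]Ct≤[t+b+c]Ct*[b+c]Cb : ∀ t b c D E →
  suc b * D + suc (t + b) * E ≤ suc b * ((t + b + c) C (t + b)) →
  D * ((t + b) C t) + E * (suc (t + b) C t) ≤ ((t + b + c) C t) * ((b + c) C b)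
D*[t+b]Ct+E*[1+t+b]Ct≤[t+b+c]Ct*[b+c]Cb t b c D E weighted≤ = *-cancelˡ-≤ (suc b) (begin
  suc b * (D * Y + E * X)                ≡⟨ distribute (suc b) D E X Y ⟩
  suc b * D * Y + E * (suc b * X)        ≡⟨ cong (λ m → suc b * D * Y + E * m) ([1+b]*[1+a+b]Ca≡[1+a+b]*[a+b]Ca t b) ⟩
  suc b * D * Y + E * (suc (t + b) * Y)  ≡⟨ collect (suc b) D E Y (suc (t + b)) ⟩
  (suc b * D + suc (t + b) * E) * Y      ≤⟨ *-monoˡ-≤ Y weighted≤ ⟩
  suc b * W * Y                          ≡⟨ *-assoc (suc b) W Y ⟩
  suc b * (W * Y)                        ≡⟨ cong (suc b *_) ([a+b+c]C[a+b]*[a+b]Ca≡[a+b+c]Ca*[b+c]Cb t b c) ⟩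
  suc b * (((t + b + c) C t) * ((b + c) C b)) ∎)
  where
  open ≤-Reasoning
  X = suc (t + b) C t
  Y = (t + b) C t
  W = (t + b + c) C (t + b)
  distribute : ∀ p d e x y → p * (d * y + e * x) ≡ p * d * y + e * (p * x)
  distribute = solve-∀
  collect : ∀ p d e y q → p * d * y + e * (q * y) ≡ (p * d + q * e) * y
  collect = solve-∀

minDegree≤[b+c]Cb : ∀ t b c (F : Family (suc (t + b + c))) (x : Fin (suc (t + b + c))) →
  degree F x ≡ maxDegree F → All (λ A → ∣ A ∣ ≡ suc (t + b)) F →
  suc b * maxDegree F + suc (t + b) * diversity F ≤ suc b * ((t + b + c) C (t + b)) →
  minDegree t F ≤ (b + c) C b
minDegree≤[b+c]Cb t b c F x D≡Δ sizes weighted≤ with find (sum≤length*m⇒Any≤m (setDegree F) M Ts 0<∣Ts∣ sum≤)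
  where
  M = (b + c) C b
  Ts = (⊤ - x) choose t
  D = degree F x
  E = count (∁? (x ∈?_)) F

  E≡γ : E ≡ diversity F
  E≡γ = sym (trans (cong₂ _∸_ (length≡count+count∁ (x ∈?_) F) (sym D≡Δ)) (m+n∸m≡n D E))

  ∣Ts∣≡ : length Ts ≡ (t + b + c) C t
  ∣Ts∣≡ = trans (length-choose (⊤ - x) t) (cong (_C t) (∣⊤-x∣≡n x))

  0<∣Ts∣ : 0 < length Ts
  0<∣Ts∣ = subst (0 <_) (sym (trans ∣Ts∣≡ (cong (_C t) (+-assoc t b c)))) (0<[a+b]Ca t (b + c))

  weighted≤′ : suc b * D + suc (t + b) * E ≤ suc b * ((t + b + c) C (t + b))
  weighted≤′ = subst₂ (λ d e → suc b * d + suc (t + b) * e ≤ _) (sym D≡Δ) (sym E≡γ) weighted≤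

  sum≤ : sum (map (setDegree F) Ts) ≤ length Ts * M
  sum≤ = begin
    sum (map (setDegree F) Ts)                ≡⟨ sum-setDegree-avoiding t x F sizes ⟩
    D * ((t + b) C t) + E * (suc (t + b) C t) ≤⟨ D*[t+b]Ct+E*[1+t+b]Ct≤[t+b+c]Ct*[b+c]Cb t b c D E weighted≤′ ⟩
    ((t + b + c) C t) * M                     ≡⟨ cong (_* M) ∣Ts∣≡ ⟨
    length Ts * M                             ∎
    where open ≤-Reasoning
... | T , T∈Ts , setDegree≤ = ≤-trans (minDegree≤setDegree t F (choose⊆subsetsOfSize T∈Ts)) setDegree≤

-- Writing k = 1 + t + b and n = 1 + t + b + c puts every binomial coefficient in the form (x + y) C x.
data Gaps (t : ℕ) : ℕ → ℕ → Set where
  gaps : ∀ b c → Gaps t (suc (t + b)) (suc (t + b + c))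

gaps-of : ∀ {t k n} → t < k → k < n → Gaps t k n
gaps-of {t} (s≤s t≤K) k<n with m≤n⇒∃[o]m+o≡n t≤K
... | b , refl with k<n
...   | s≤s k≤N with m≤n⇒∃[o]m+o≡n k≤N
...     | c , refl = subst (λ m → Gaps t (suc (t + b)) (suc m)) (+-suc (t + b) c) (gaps b (suc c))

1+[t+b]∸t≡1+b : ∀ t b → suc (t + b) ∸ t ≡ suc b
1+[t+b]∸t≡1+b t b = trans (cong (_∸ t) (sym (+-suc t b))) (m+n∸m≡n t (suc b))

proposition11 : (n k t : ℕ) → 1 ≤ t → t < k → k < n →
    (F : Family n) → IsKUniformFamily k F → Intersecting F →
    (k ∸ t) * maxDegree F + k * diversity F ≤ (k ∸ t) * ((n ∸ 1) C (k ∸ 1)) →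
    minDegree t F ≤ (n ∸ t ∸ 1) C (k ∸ t ∸ 1)
proposition11 n k t _ t<k k<n F (_ , sizes) _ weighted≤ with gaps-of t<k k<n
... | gaps b c with maxDegree-attained F
...   | x , D≡Δ =
  subst₂ (λ u v → minDegree t F ≤ (u ∸ 1) C (v ∸ 1)) (sym n∸t≡1+b+c) (sym (1+[t+b]∸t≡1+b t b))
    (minDegree≤[b+c]Cb t b c F x D≡Δ sizes
      (subst (λ m → m * maxDegree F + suc (t + b) * diversity F ≤ m * ((t + b + c) C (t + b)))
             (1+[t+b]∸t≡1+b t b) weighted≤))
  where
  n∸t≡1+b+c : suc (t + b + c) ∸ t ≡ suc (b + c)
  n∸t≡1+b+c = trans (cong (λ m → suc m ∸ t) (+-assoc t b c)) (1+[t+b]∸t≡1+b t (b + c))
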